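{- Fix $k\ge2$ and let $\pi$ be a permutation containing a decreasing subsequence of length $k$, with B-sequence $b_k\cdots b_1$. Let $1\le i\le j\le k-1$. Suppose $\pi$ contains a decreasing subsequence of the form $b_{j+1}x_jx_{j-1}\cdots x_i$ such that $x_i$ precedes $b_i$. Then $\ell(x_i)<\ell(b_i)$.
   Context: Letters of $\pi$ are identified with their values; "$x$ precedes $y$" means $x$ is at a smaller position. The B-sequence $b_k\cdots b_1$ is defined recursively: $b_1$ is the leftmost letter that is the last letter of a decreasing subsequence of length $k$, and for $j\ge2$, $b_j$ is the leftmost letter such that $b_j\cdots b_1$ is a suffix of a decreasing subsequence of length $k$. The label $\ell(x)$ of a letter $x$ is the maximal length of a decreasing subsequence of $\pi$ starting at $x$. -}

module Defs where

open import Data.Nat using (ℕ; zero; suc; _+_; _∸_; _≤_; _<_)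
open import Data.Fin as Fin using (Fin)
open import Data.List using (List; []; _∷_; _++_; length)
open import Data.Product using (Σ; ∃; ∃-syntax; _×_; _,_)
open import Function.Definitions using (Injective)
open import Relation.Binary.PropositionalEquality using (_≡_)

-- A permutation of [n]: an injective (hence bijective) map from positions to values.
-- Letters are values; we work with positions p : Fin n and the letter π p.
record Perm (n : ℕ) : Set where
  field
    fun : Fin n → Fin n
    inj : Injective _≡_ _≡_ fun
open Perm public

data DecSeq {n : ℕ} (π : Perm n) : List (Fin n) → Set where
  []  : DecSeq π []
  [_] : (p : Fin n) → DecSeq π (p ∷ [])
  _∷_ : ∀ {p q ps} → (p Fin.< q) × (fun π q Fin.< fun π p) →
        DecSeq π (q ∷ ps) → DecSeq π (p ∷ q ∷ ps)

HasDec : ∀ {n} → Perm n → ℕ → Set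
HasDec π k = ∃[ ps ] (DecSeq π ps × length ps ≡ k)

SuffixOfDec : ∀ {n} → Perm n → ℕ → List (Fin n) → Set
SuffixOfDec π k ws = ∃[ ps ] (DecSeq π ps × length ps ≡ k × ∃[ pre ] ps ≡ pre ++ ws)

bList : ∀ {n} → (ℕ → Fin n) → ℕ → List (Fin n)
bList b zero    = []
bList b (suc j) = b (suc j) ∷ bList b j

-- b is the B-sequence b_k ⋯ b_1 of π: for each 1 ≤ j ≤ k, b_j is the
-- leftmost letter such that b_j ⋯ b_1 is a suffix of a decreasing
-- subsequence of length k.  (For j = 1 this says: b_1 is the leftmost letter
-- that is the last letter of a decreasing subsequence of length k.)
IsBSeq : ∀ {n} → Perm n → ℕ → (ℕ → Fin n) → Set
IsBSeq π k b = ∀ j → 1 ≤ j → j ≤ k →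
  SuffixOfDec π k (bList b j) ×
  (∀ y → SuffixOfDec π k (y ∷ bList b (j ∸ 1)) → b j Fin.≤ y)

seg : ∀ {n} → (ℕ → Fin n) → ℕ → ℕ → List (Fin n)
seg x i zero    = x i ∷ []
seg x i (suc d) = x (i + suc d) ∷ seg x i d

-- L is the label ℓ(p): the maximal length of a decreasing subsequence starting at p.
IsLabel : ∀ {n} → Perm n → Fin n → ℕ → Set
IsLabel π p L =
  (∃[ ps ] (DecSeq π (p ∷ ps) × length (p ∷ ps) ≡ L)) ×
  (∀ ps → DecSeq π (p ∷ ps) → length (p ∷ ps) ≤ L)

-- Call y dominated by z if every decreasing subsequence starting at y is beaten by a strictly
-- longer one starting at z; then ℓ(y) < ℓ(z).  We show by induction on i that a letter y
-- preceding b_i and ending a decreasing subsequence of length k − i + 1 is dominated by b_i.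
-- For i = 1 no such y exists, by the minimality of b_1.  For i > 1, π(y) > π(b_{i-1}) would
-- let y replace b_i in the B-sequence, so π(y) < π(b_{i-1}); the next letter d after y in a
-- decreasing subsequence either follows b_{i-1}, and then b_i b_{i-1} d ⋯ is longer, or
-- precedes it, and then d is dominated by b_{i-1} by induction.  The letter x_i of the
-- theorem is such a y, since b_{j+1} x_j ⋯ x_i extends a decreasing subsequence ending at
-- b_{j+1} of length k − j.
module Submission where

open import Defs
open import Data.Nat using (ℕ; zero; suc; _+_; _∸_; _≤_; _<_; z≤n; s≤s)
open import Data.Nat.Properties
  using (+-suc; +-comm; +-assoc; m∸n+n≡m; m≤n+m; ≤-trans; ≤-reflexive; <⇒≱; <-≤-trans; n<1+n)
open import Data.Fin as Fin using (Fin)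
import Data.Fin.Properties as Fin
open import Data.List using ([]; _∷_; _++_; _∷ʳ_; length)
open import Data.List.Properties using (length-++; ++-assoc)
open import Data.Product using (∃-syntax; _×_; _,_; proj₁; proj₂)
open import Data.Empty using (⊥-elim)
open import Relation.Nullary using (¬_)
open import Relation.Binary.Definitions using (tri<; tri≈; tri>)
open import Relation.Binary.PropositionalEquality
  using (_≡_; refl; sym; trans; cong; subst; module ≡-Reasoning)

module _ {n : ℕ} (π : Perm n) where

  DecSeq-tail : ∀ {p ps} → DecSeq π (p ∷ ps) → DecSeq π ps
  DecSeq-tail [ _ ]   = []
  DecSeq-tail (_ ∷ D) = D

  DecSeq-++⁻ʳ : ∀ pre {ws} → DecSeq π (pre ++ ws) → DecSeq π ws
  DecSeq-++⁻ʳ []        D = D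
  DecSeq-++⁻ʳ (_ ∷ pre) D = DecSeq-++⁻ʳ pre (DecSeq-tail D)

  DecSeq-prefix : ∀ pre y ws → DecSeq π (pre ++ y ∷ ws) → DecSeq π (pre ∷ʳ y)
  DecSeq-prefix []            y ws D       = [ y ]
  DecSeq-prefix (p ∷ [])      y ws (h ∷ D) = h ∷ [ y ]
  DecSeq-prefix (p ∷ q ∷ pre) y ws (h ∷ D) = h ∷ DecSeq-prefix (q ∷ pre) y ws D

  DecSeq-join : ∀ pre y ws → DecSeq π (pre ∷ʳ y) → DecSeq π (y ∷ ws) → DecSeq π (pre ++ y ∷ ws)
  DecSeq-join []            y ws D       E = E
  DecSeq-join (p ∷ [])      y ws (h ∷ D) E = h ∷ E
  DecSeq-join (p ∷ q ∷ pre) y ws (h ∷ D) E = h ∷ DecSeq-join (q ∷ pre) y ws D E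

  EndsDec : ℕ → Fin n → Set
  EndsDec m y = ∃[ pre ] (DecSeq π (pre ∷ʳ y) × length pre ≡ m)

  suffix⇒DecSeq : ∀ {k ws} → SuffixOfDec π k ws → DecSeq π ws
  suffix⇒DecSeq (_ , D , _ , pre , refl) = DecSeq-++⁻ʳ pre D

  suffix⇒EndsDec : ∀ {k y ws} → SuffixOfDec π k (y ∷ ws) →
    ∃[ m ] (EndsDec m y × m + suc (length ws) ≡ k)
  suffix⇒EndsDec {y = y} {ws} (_ , D , len , pre , refl) =
    length pre , (pre , DecSeq-prefix pre y ws D , refl) , trans (sym (length-++ pre)) len

  EndsDec⇒suffix : ∀ {k m y ws} → EndsDec m y → DecSeq π (y ∷ ws) →
    m + suc (length ws) ≡ k → SuffixOfDec π k (y ∷ ws)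
  EndsDec⇒suffix {y = y} {ws} (pre , D , refl) E len =
    pre ++ y ∷ ws , DecSeq-join pre y ws D E , trans (length-++ pre) len , pre , refl

  EndsDec-step : ∀ {m y z zs} → EndsDec m y → DecSeq π (y ∷ z ∷ zs) → EndsDec (suc m) z
  EndsDec-step {y = y} {z} (pre , D , refl) (h ∷ _) =
    pre ∷ʳ y ,
    subst (DecSeq π) (sym (++-assoc pre (y ∷ []) (z ∷ []))) (DecSeq-join pre y (z ∷ []) D (h ∷ [ z ])) ,
    trans (length-++ pre) (+-comm (length pre) 1)

  EndsDec-seg : ∀ {m y} x i d → EndsDec m y → DecSeq π (y ∷ seg x i d) → EndsDec (m + suc d) (x i)
  EndsDec-seg {m} x i zero    e D =
    subst (λ m′ → EndsDec m′ (x i)) (+-comm 1 m) (EndsDec-step e D)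
  EndsDec-seg {m} x i (suc d) e D =
    subst (λ m′ → EndsDec m′ (x i)) (sym (+-suc m (suc d)))
      (EndsDec-seg x i d (EndsDec-step e D) (DecSeq-tail D))

  LabelBelow : Fin n → Fin n → Set
  LabelBelow y z = ∀ ps → DecSeq π (y ∷ ps) → ∃[ qs ] (DecSeq π (z ∷ qs) × length ps < length qs)

  LabelBelow⇒< : ∀ {y z Ly Lz} → LabelBelow y z → IsLabel π y Ly → IsLabel π z Lz → Ly < Lz
  LabelBelow⇒< below ((ps , D , refl) , _) (_ , maximal) with below ps D
  ... | qs , E , shorter = <-≤-trans (s≤s shorter) (maximal qs E)

  LabelBelow-step : ∀ {y z z′} → (z Fin.< z′) × (fun π z′ Fin.< fun π z) → fun π y Fin.< fun π z′ →
    (∀ d → DecSeq π (y ∷ d ∷ []) → d Fin.< z′ → LabelBelow d z′) → LabelBelow y z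
  LabelBelow-step zz′ _ _ [] _ = _ ∷ [] , zz′ ∷ [ _ ] , s≤s z≤n
  LabelBelow-step {z′ = z′} zz′ y<z′ below (d ∷ ps) (yd@(_ , d<y) ∷ D) with Fin.<-cmp d z′
  ... | tri< d<z′ _ _ with below d (yd ∷ [ d ]) d<z′ ps D
  ...   | qs , E , shorter = z′ ∷ qs , zz′ ∷ E , s≤s shorter
  LabelBelow-step zz′ y<z′ below (d ∷ ps) ((_ , d<y) ∷ D) | tri≈ _ refl _ =
    ⊥-elim (Fin.<-asym d<y y<z′)
  LabelBelow-step zz′ y<z′ below (d ∷ ps) ((_ , d<y) ∷ D) | tri> _ _ z′<d =
    _ ∷ d ∷ ps , zz′ ∷ (z′<d , Fin.<-trans d<y y<z′) ∷ D , n<1+n _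

length-bList : ∀ {n} (b : ℕ → Fin n) i → length (bList b i) ≡ i
length-bList b zero    = refl
length-bList b (suc i) = cong suc (length-bList b i)

module _ {n k} {π : Perm n} {b : ℕ → Fin n} (B : IsBSeq π k b) where

  private
    summand≤ : ∀ {m i} → m + i ≡ k → i ≤ k
    summand≤ {m} {i} eq = ≤-trans (m≤n+m i m) (≤-reflexive eq)

  b-DecSeq : ∀ i → suc i ≤ k → DecSeq π (bList b (suc i))
  b-DecSeq i i<k = suffix⇒DecSeq π (proj₁ (B (suc i) (s≤s z≤n) i<k))

  b-EndsDec : ∀ j → suc j ≤ k → ∃[ m ] (EndsDec π m (b (suc j)) × m + suc j ≡ k)
  b-EndsDec j j<k with suffix⇒EndsDec π (proj₁ (B (suc j) (s≤s z≤n) j<k))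
  ... | m , e , len = m , e , subst (λ l → m + suc l ≡ k) (length-bList b j) len

  b-leftmost : ∀ {i m y} → EndsDec π m y → DecSeq π (y ∷ bList b i) → m + suc i ≡ k →
    ¬ (y Fin.< b (suc i))
  b-leftmost {i} {m} {y} e D eq y<b =
    <⇒≱ y<b (proj₂ (B (suc i) (s≤s z≤n) (summand≤ eq)) y
      (EndsDec⇒suffix π e D (subst (λ l → m + suc l ≡ k) (sym (length-bList b i)) eq)))

  b-dominates : ∀ i {m y} → EndsDec π m y → m + suc i ≡ k → y Fin.< b (suc i) →
    LabelBelow π y (b (suc i))
  b-dominates zero e eq y<b = ⊥-elim (b-leftmost e [ _ ] eq y<b)
  b-dominates (suc i) {m} {y} e eq y<b
    with b-DecSeq (suc i) (summand≤ eq) | Fin.<-cmp (fun π y) (fun π (b (suc i)))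
  ... | bb@(b<b′ , _) ∷ _ | tri< y<b′ _ _ =
    LabelBelow-step π bb y<b′ λ d D d<b′ →
      b-dominates i (EndsDec-step π e D) (trans (sym (+-suc m (suc i))) eq) d<b′
  ... | (b<b′ , _) ∷ _ | tri≈ _ y≡b′ _ =
    ⊥-elim (Fin.<-irrefl (Perm.inj π y≡b′) (Fin.<-trans y<b b<b′))
  ... | (b<b′ , _) ∷ D | tri> _ _ b′<y =
    ⊥-elim (b-leftmost e ((Fin.<-trans y<b b<b′ , b′<y) ∷ D) eq y<b)

lemma18 : (n k : ℕ) → 2 ≤ k → (π : Perm n) → HasDec π k →
    (b : ℕ → Fin n) → IsBSeq π k b →
    (i j : ℕ) → 1 ≤ i → i ≤ j → j ≤ k ∸ 1 →
    (x : ℕ → Fin n) → DecSeq π (b (suc j) ∷ seg x i (j ∸ i)) →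
    x i Fin.< b i →
    (Lx Lb : ℕ) → IsLabel π (x i) Lx → IsLabel π (b i) Lb → Lx < Lb
lemma18 n (suc k) (s≤s _) π _ b B (suc i) j (s≤s z≤n) i≤j j≤k x D xi<bi Lx Lb ℓx ℓb
  with b-EndsDec B j (s≤s j≤k)
... | m , e , eq =
  LabelBelow⇒< π (b-dominates B i (EndsDec-seg π x (suc i) d e D) length-xi xi<bi) ℓx ℓb
  where
  open ≡-Reasoning
  d = j ∸ suc i
  length-xi : m + suc d + suc i ≡ suc k
  length-xi = begin
    m + suc d + suc i   ≡⟨ +-assoc m (suc d) (suc i) ⟩
    m + suc (d + suc i) ≡⟨ cong (λ l → m + suc l) (m∸n+n≡m i≤j) ⟩
    m + suc j           ≡⟨ eq ⟩
    suc k               ∎
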